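{- Let $G$ and $H$ be graphs with $|V(G)| \ge 2$, $|V(H)| \ge 2$, and $|E(G)| + |E(H)| \ge 1$. Then $F(G \vee H) = \alpha(G \vee H)$.
   Context: Peg solitaire on a graph: a configuration assigns to each vertex either a peg or a hole. If $x,y,z$ form a path $xyz$ with pegs at $x$ and $y$ and a hole at $z$, a jump $xyz$ removes the pegs at $x$ and $y$ and places a peg at $z$. A terminal state of a graph $G$ is the set of peg locations when no jump is available, reached by some sequence of jumps from a starting configuration with exactly one hole (and pegs on all other vertices). The fool's solitaire number $F(G)$ is the maximum size of a terminal state of $G$. $\alpha(G)$ is the independence number. The join $G \vee H$ is obtained from the disjoint union of $G$ and $H$ by adding all edges between $V(G)$ and $V(H)$. -}

module Defs where

open import Data.Nat using (ℕ; zero; suc; _+_; _≤_; _<ᵇ_)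
open import Data.Bool using (Bool; true; false; _∧_; if_then_else_)
open import Data.Fin using (Fin; toℕ; splitAt)
open import Data.Fin.Subset using (Subset; _∈_; _∉_; ∣_∣; inside; outside)
open import Data.Vec using (_[_]≔_)
open import Data.List using (map; allFin)
open import Data.Nat.ListAction using (sum)
open import Data.Sum using (_⊎_; inj₁; inj₂)
open import Data.Product using (Σ; ∃; _×_; _,_)
open import Relation.Binary.PropositionalEquality using (_≡_; _≢_; refl)
open import Relation.Nullary using (¬_)

record Graph (n : ℕ) : Set where
  field
    adj    : Fin n → Fin n → Bool
    sym    : ∀ i j → adj i j ≡ adj j i
    irrefl : ∀ i → adj i i ≡ false
open Graph public

order : ∀ {n} → Graph n → ℕ
order {n} _ = n

numEdges : ∀ {n} → Graph n → ℕ
numEdges {n} G =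
  sum (map (λ i → sum (map (λ j → if (toℕ i <ᵇ toℕ j) ∧ adj G i j then 1 else 0)
                           (allFin n)))
           (allFin n))

joinAdj⊎ : ∀ {m n} → Graph m → Graph n → Fin m ⊎ Fin n → Fin m ⊎ Fin n → Bool
joinAdj⊎ G H (inj₁ i) (inj₁ j) = adj G i j
joinAdj⊎ G H (inj₂ i) (inj₂ j) = adj H i j
joinAdj⊎ G H (inj₁ i) (inj₂ j) = true
joinAdj⊎ G H (inj₂ i) (inj₁ j) = true

joinAdj⊎-sym : ∀ {m n} (G : Graph m) (H : Graph n) x y → joinAdj⊎ G H x y ≡ joinAdj⊎ G H y x
joinAdj⊎-sym G H (inj₁ i) (inj₁ j) = sym G i j
joinAdj⊎-sym G H (inj₂ i) (inj₂ j) = sym H i j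
joinAdj⊎-sym G H (inj₁ i) (inj₂ j) = refl
joinAdj⊎-sym G H (inj₂ i) (inj₁ j) = refl

joinAdj⊎-irrefl : ∀ {m n} (G : Graph m) (H : Graph n) x → joinAdj⊎ G H x x ≡ false
joinAdj⊎-irrefl G H (inj₁ i) = irrefl G i
joinAdj⊎-irrefl G H (inj₂ i) = irrefl H i

_∨ᴳ_ : ∀ {m n} → Graph m → Graph n → Graph (m + n)
_∨ᴳ_ {m} G H = record
  { adj    = λ i j → joinAdj⊎ G H (splitAt m i) (splitAt m j)
  ; sym    = λ i j → joinAdj⊎-sym G H (splitAt m i) (splitAt m j)
  ; irrefl = λ i → joinAdj⊎-irrefl G H (splitAt m i)
  }

Independent : ∀ {n} → Graph n → Subset n → Set
Independent G S = ∀ i j → i ∈ S → j ∈ S → adj G i j ≡ false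

IsMaxSize : ∀ {n} → (Subset n → Set) → ℕ → Set
IsMaxSize {n} P k = (Σ (Subset n) λ S → P S × ∣ S ∣ ≡ k)
                  × (∀ S → P S → ∣ S ∣ ≤ k)

IsIndependenceNumber : ∀ {n} → Graph n → ℕ → Set
IsIndependenceNumber G = IsMaxSize (Independent G)

-- A configuration is the set of vertices carrying a peg.
data Jump {n} (G : Graph n) : Subset n → Subset n → Set where
  jump : ∀ (c : Subset n) (x y z : Fin n) →
         x ≢ z → adj G x y ≡ true → adj G y z ≡ true →
         x ∈ c → y ∈ c → z ∉ c →
         Jump G c (((c [ x ]≔ outside) [ y ]≔ outside) [ z ]≔ inside)

data Reach {n} (G : Graph n) : Subset n → Subset n → Set where
  done : ∀ c → Reach G c c
  step : ∀ {c d e} → Jump G c d → Reach G d e → Reach G c e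

OneHole : ∀ {n} → Subset n → Set
OneHole {n} c = Σ (Fin n) λ h → h ∉ c × (∀ v → v ≢ h → v ∈ c)

NoJump : ∀ {n} → Graph n → Subset n → Set
NoJump G c = ∀ d → ¬ Jump G c d

Terminal : ∀ {n} → Graph n → Subset n → Set
Terminal G t = NoJump G t × Σ _ λ s → OneHole s × Reach G s t

IsFoolsSolitaireNumber : ∀ {n} → Graph n → ℕ → Set
IsFoolsSolitaireNumber G = IsMaxSize (Terminal G)

module Submission where

-- Every configuration reached from one
-- hole still has a hole, and two adjacent pegs next to a hole always admit a jump (through a vertex of
-- the other side if necessary), so terminal states are independent and F ≤ α.
-- Conversely, a nonempty independent set S lies inside one side, and it is reached from a single hole
-- by sweeps: if p and h are adjacent to every vertex of a set L of pegs and exactly one of them holds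
-- a peg, the jumps p b h, h b′ p, … clear L while the peg bounces between p and h, ending on p or h
-- according to the parity of |L|. Choosing the first hole and the order of the sweeps by parity, one
-- clears the vertices of S's side outside S and all of the other side; when S is a whole side, the
-- last two pegs of the other side are removed by a jump along one of its edges. Two vertices on each
-- side serve as the pivots.

open import Defs renaming (sym to adj-sym)
open import Data.Bool using (Bool; true; false; not; if_then_else_; _∧_)
import Data.Bool as Bool
open import Data.Bool.Properties using (not-¬; ¬-not)
open import Data.Empty using (⊥-elim)
open import Data.Fin using (Fin; zero; suc; _≟_; toℕ; splitAt; _↑ˡ_; _↑ʳ_)
open import Data.Fin.Properties using (any?; 0≢1+n; ↑ʳ-injective; splitAt-↑ˡ; splitAt-↑ʳ)
open import Data.Fin.Subset using (Subset; _∈_; _∉_; ⊤; ⊥; ∣_∣; ⁅_⁆; Nonempty; inside; outside)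
open import Data.Fin.Subset.Properties using (_∈?_; nonempty?; Empty-unique; ∣⊥∣≡0; ∣⁅x⁆∣≡1; x∈⁅y⁆⇒x≡y)
open import Data.List using (List; []; _∷_; filter; map; allFin)
open import Data.List.Membership.Propositional using () renaming (_∈_ to _∈ₗ_; _∉_ to _∉ₗ_)
open import Data.List.Membership.Propositional.Properties using (∈-filter⁺; ∈-filter⁻; ∈-allFin)
open import Data.List.Relation.Unary.All as All using ()
open import Data.List.Relation.Unary.Any using (here; there)
open import Data.List.Relation.Unary.Unique.Propositional using (Unique; _∷_)
open import Data.List.Relation.Unary.Unique.Propositional.Properties using (filter⁺; allFin⁺)
open import Data.Nat using (ℕ; _+_; _≤_; s≤s; _<ᵇ_)
open import Data.Nat.ListAction using (sum)
open import Data.Nat.Properties using (n≮n; module ≤-Reasoning)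
open import Data.Product using (∃-syntax; _×_; _,_; proj₁; proj₂)
open import Data.Sum using (_⊎_; inj₁; inj₂)
open import Data.Vec using (Vec; lookup; _[_]≔_)
open import Data.Vec.Properties
  using (lookup⇒[]=; []=⇒lookup; lookup∘update; lookup∘update′; lookup-replicate; tabulate∘lookup; tabulate-cong)
open import Relation.Binary.PropositionalEquality
  using (_≡_; _≢_; refl; sym; trans; cong; cong₂; subst)
open import Relation.Nullary using (¬_; Dec; yes; no)
open import Relation.Nullary.Decidable using (_×-dec_; ¬?)
open import Relation.Unary using (Decidable)
open import Function using (_∘_)

lookup-ext : ∀ {A : Set} {n} {xs ys : Vec A n} → (∀ i → lookup xs i ≡ lookup ys i) → xs ≡ ys
lookup-ext {xs = xs} {ys} eq = trans (sym (tabulate∘lookup xs)) (trans (tabulate-cong eq) (tabulate∘lookup ys))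

lookup≡false⇒∉ : ∀ {n} {p : Subset n} {x} → lookup p x ≡ false → x ∉ p
lookup≡false⇒∉ px≡false x∈p with () ← trans (sym ([]=⇒lookup x∈p)) px≡false

independent-¬adj : ∀ {n} {G : Graph n} {S x y} → Independent G S → x ∈ S → y ∈ S → ¬ adj G x y ≡ true
independent-¬adj {x = x} {y} S-indep x∈S y∈S xy with () ← trans (sym xy) (S-indep x y x∈S y∈S)

⁅⁆-independent : ∀ {k} (K : Graph k) x → Independent K ⁅ x ⁆
⁅⁆-independent K x i j i∈ j∈ rewrite x∈⁅y⁆⇒x≡y x i∈ | x∈⁅y⁆⇒x≡y x j∈ = irrefl K x

maximum-independent-nonempty : ∀ {k} (K : Graph k) → Fin k → ∀ {S : Subset k} {a} → ∣ S ∣ ≡ a →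
                               (∀ S′ → Independent K S′ → ∣ S′ ∣ ≤ a) → Nonempty S
maximum-independent-nonempty {k} K x {S} {a} ∣S∣≡a S-max with nonempty? S
... | yes S-nonempty = S-nonempty
... | no  S-empty    = ⊥-elim (n≮n 0 (begin
  1           ≡⟨ ∣⁅x⁆∣≡1 x ⟨
  ∣ ⁅ x ⁆ ∣   ≤⟨ S-max ⁅ x ⁆ (⁅⁆-independent K x) ⟩
  a           ≡⟨ ∣S∣≡a ⟨
  ∣ S ∣       ≡⟨ cong ∣_∣ (Empty-unique S-empty) ⟩
  ∣ ⊥ {k} ∣   ≡⟨ ∣⊥∣≡0 k ⟩
  0           ∎))
  where open ≤-Reasoning

sum-map-zero : ∀ {A : Set} (f : A → ℕ) → (∀ x → f x ≡ 0) → ∀ xs → sum (map f xs) ≡ 0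
sum-map-zero f f≡0 []       = refl
sum-map-zero f f≡0 (x ∷ xs) rewrite f≡0 x = sum-map-zero f f≡0 xs

has-edge? : ∀ {k} (G : Graph k) → Dec (∃[ i ] ∃[ j ] adj G i j ≡ true)
has-edge? G = any? λ i → any? λ j → adj G i j Bool.≟ true

edgeless⇒numEdges≡0 : ∀ {k} (G : Graph k) → ¬ (∃[ i ] ∃[ j ] adj G i j ≡ true) → numEdges G ≡ 0
edgeless⇒numEdges≡0 {k} G edgeless =
  sum-map-zero _ (λ i → sum-map-zero _ (λ j → not-counted (toℕ i <ᵇ toℕ j) (no-edge i j)) (allFin k)) (allFin k)
  where
  no-edge : ∀ i j → adj G i j ≡ false
  no-edge i j with adj G i j in ij
  ... | true  = ⊥-elim (edgeless (i , j , ij))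
  ... | false = refl
  not-counted : ∀ c {e} → e ≡ false → (if c ∧ e then 1 else 0) ≡ 0
  not-counted true  refl = refl
  not-counted false refl = refl

evenLength : ∀ {A : Set} → List A → Bool
evenLength []       = true
evenLength (_ ∷ xs) = not (evenLength xs)

module Enumeration {N : ℕ} {P : Fin N → Set} (P? : Decidable P) where

  enumerate : List (Fin N)
  enumerate = filter P? (allFin N)

  ∈-enumerate⁺ : ∀ {v} → P v → v ∈ₗ enumerate
  ∈-enumerate⁺ = ∈-filter⁺ P? (∈-allFin _)

  ∈-enumerate⁻ : ∀ {v} → v ∈ₗ enumerate → P v
  ∈-enumerate⁻ v∈ = proj₂ (∈-filter⁻ P? {xs = allFin N} v∈)

  enumerate-unique : Unique enumerate
  enumerate-unique = filter⁺ P? (allFin⁺ N)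

module Solitaire {N : ℕ} (K : Graph N) where

  infix 4 _⇝_
  _⇝_ : Subset N → Subset N → Set
  _⇝_ = Reach K

  ⇝-trans : ∀ {c d e} → c ⇝ d → d ⇝ e → c ⇝ e
  ⇝-trans (done _)   d⇝e = d⇝e
  ⇝-trans (step j r) d⇝e = step j (⇝-trans r d⇝e)

  adj⇒≢ : ∀ {x y} → adj K x y ≡ true → x ≢ y
  adj⇒≢ {x} xy refl with () ← trans (sym xy) (irrefl K x)

  adj-flip : ∀ {x y} → adj K x y ≡ true → adj K y x ≡ true
  adj-flip {x} {y} xy = trans (adj-sym K y x) xy

  jumped : Subset N → Fin N → Fin N → Fin N → Subset N
  jumped c x y z = ((c [ x ]≔ outside) [ y ]≔ outside) [ z ]≔ inside

  jumped-target : ∀ c x y z → lookup (jumped c x y z) z ≡ true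
  jumped-target c x y z = lookup∘update z ((c [ x ]≔ outside) [ y ]≔ outside) inside

  jumped-middle : ∀ c x {y z} → y ≢ z → lookup (jumped c x y z) y ≡ false
  jumped-middle c x {y} y≢z =
    trans (lookup∘update′ y≢z ((c [ x ]≔ outside) [ y ]≔ outside) inside) (lookup∘update y (c [ x ]≔ outside) outside)

  jumped-source : ∀ c {x} y {z} → x ≢ z → lookup (jumped c x y z) x ≡ false
  jumped-source c {x} y x≢z with x ≟ y
  ... | yes refl = jumped-middle c x x≢z
  ... | no x≢y   = trans (lookup∘update′ x≢z ((c [ x ]≔ outside) [ y ]≔ outside) inside)
                     (trans (lookup∘update′ x≢y (c [ x ]≔ outside) outside) (lookup∘update x c outside))

  jumped-frame : ∀ c {x y z v} → v ≢ x → v ≢ y → v ≢ z → lookup (jumped c x y z) v ≡ lookup c v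
  jumped-frame c {x} {y} v≢x v≢y v≢z =
    trans (lookup∘update′ v≢z ((c [ x ]≔ outside) [ y ]≔ outside) inside)
      (trans (lookup∘update′ v≢y (c [ x ]≔ outside) outside) (lookup∘update′ v≢x c outside))

  jump-⇝ : ∀ {c x y z} → x ≢ z → adj K x y ≡ true → adj K y z ≡ true →
           lookup c x ≡ true → lookup c y ≡ true → lookup c z ≡ false → c ⇝ jumped c x y z
  jump-⇝ {c} {x} {y} {z} x≢z xy yz cx cy cz =
    step (jump c x y z x≢z xy yz (lookup⇒[]= x c cx) (lookup⇒[]= y c cy) (lookup≡false⇒∉ cz)) (done _)

  hole-persists : ∀ {c d} → c ⇝ d → ∃[ h ] h ∉ c → ∃[ h ] h ∉ d
  hole-persists (done _) hole = hole
  hole-persists (step (jump c x y z x≢z _ _ _ _ _) r) _ =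
    hole-persists r (x , lookup≡false⇒∉ (jumped-source c y x≢z))

  fullBut : Fin N → Subset N
  fullBut h = ⊤ [ h ]≔ outside

  fullBut-hole : ∀ h → lookup (fullBut h) h ≡ false
  fullBut-hole h = lookup∘update h ⊤ outside

  fullBut-peg : ∀ {h v} → v ≢ h → lookup (fullBut h) v ≡ true
  fullBut-peg {h} {v} v≢h = trans (lookup∘update′ v≢h ⊤ outside) (lookup-replicate v inside)

  fullBut-oneHole : ∀ h → OneHole (fullBut h)
  fullBut-oneHole h = h , lookup≡false⇒∉ (fullBut-hole h) , λ v v≢h → lookup⇒[]= v _ (fullBut-peg v≢h)

  PegAt : Subset N → Fin N → Fin N → Set
  PegAt c p h = lookup c p ≡ true × lookup c h ≡ false

  PegAt⇒≢ : ∀ {c p h} → PegAt c p h → p ≢ h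
  PegAt⇒≢ (cp , ch) refl with () ← trans (sym cp) ch

  PegAtIf : Bool → Subset N → Fin N → Fin N → Set
  PegAtIf true  c p h = PegAt c p h
  PegAtIf false c p h = PegAt c h p

  PegAtIf-swap : ∀ b {c p h} → PegAtIf b c h p → PegAtIf (not b) c p h
  PegAtIf-swap true  peg = peg
  PegAtIf-swap false peg = peg

  PegAtIf⇒PegAt : ∀ b {c p h} → PegAtIf b c p h → PegAt c p h ⊎ PegAt c h p
  PegAtIf⇒PegAt true  peg = inj₁ peg
  PegAtIf⇒PegAt false peg = inj₂ peg

  record Swept (c : Subset N) (L : List (Fin N)) (p h : Fin N) : Set where
    field
      result  : Subset N
      reach   : c ⇝ result
      cleared : ∀ {v} → v ∈ₗ L → lookup result v ≡ false
      framed  : ∀ {v} → v ∉ₗ L → v ≢ p → v ≢ h → lookup result v ≡ lookup c v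
      pivots  : PegAtIf (evenLength L) result p h

  Sweepable : Subset N → Fin N → Fin N → Fin N → Set
  Sweepable c p h v = lookup c v ≡ true × adj K p v ≡ true × adj K h v ≡ true

  sweep : ∀ L {c p h} → Unique L → PegAt c p h → (∀ {v} → v ∈ₗ L → Sweepable c p h v) → Swept c L p h
  sweep [] {c} _ peg _ = record
    { result = c ; reach = done c ; cleared = λ () ; framed = λ _ _ _ → refl ; pivots = peg }
  sweep (b ∷ L) {c} {p} {h} (b≢L ∷ L-unique) (cp , ch) sweepable = record
    { result  = result
    ; reach   = ⇝-trans (jump-⇝ {c} p≢h pb (adj-flip hb) cp cb ch) reach
    ; cleared = λ { (here refl) → trans (framed b∉L b≢h b≢p) (jumped-middle c p b≢h)
                  ; (there v∈L) → cleared v∈L }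
    ; framed  = λ v∉ v≢p v≢h →
        trans (framed (v∉ ∘ there) v≢h v≢p) (jumped-frame c v≢p (v∉ ∘ here) v≢h)
    ; pivots  = PegAtIf-swap (evenLength L) pivots
    }
    where
    p≢h : p ≢ h
    p≢h = PegAt⇒≢ {c} (cp , ch)
    cb : lookup c b ≡ true
    cb = proj₁ (sweepable (here refl))
    pb : adj K p b ≡ true
    pb = proj₁ (proj₂ (sweepable (here refl)))
    hb : adj K h b ≡ true
    hb = proj₂ (proj₂ (sweepable (here refl)))
    b≢h : b ≢ h
    b≢h = adj⇒≢ hb ∘ sym
    b≢p : b ≢ p
    b≢p = adj⇒≢ pb ∘ sym
    b∉L : b ∉ₗ L
    b∉L b∈L = All.lookup b≢L b∈L refl
    c' : Subset N
    c' = jumped c p b h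
    sweepable' : ∀ {v} → v ∈ₗ L → Sweepable c' h p v
    sweepable' v∈L with sweepable (there v∈L)
    ... | cv , pv , hv =
      trans (jumped-frame c (adj⇒≢ pv ∘ sym) (All.lookup b≢L v∈L ∘ sym) (adj⇒≢ hv ∘ sym)) cv , hv , pv
    rest : Swept c' L h p
    rest = sweep L L-unique (jumped-target c p b h , jumped-source c b p≢h) sweepable'
    open Swept rest

  record ClearedFromOneHole (L : List (Fin N)) (h : Fin N) : Set where
    field
      start   : Fin N
      result  : Subset N
      reach   : fullBut start ⇝ result
      cleared : ∀ {v} → v ∈ₗ L → lookup result v ≡ false
      hole    : lookup result h ≡ false
      pegs    : ∀ {v} → v ∉ₗ L → v ≢ h → lookup result v ≡ true

  -- Starting from a hole at h or at p, chosen by the parity of L, the final peg lands on p.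
  clear-from-one-hole : ∀ L {p h} → p ≢ h → Unique L →
                        (∀ {v} → v ∈ₗ L → adj K p v ≡ true × adj K h v ≡ true) → ClearedFromOneHole L h
  clear-from-one-hole L {p} {h} p≢h L-unique adjacent = by-parity (evenLength L) refl
    where
    v≢p : ∀ {v} → v ∈ₗ L → v ≢ p
    v≢p v∈L = adj⇒≢ (proj₁ (adjacent v∈L)) ∘ sym
    v≢h : ∀ {v} → v ∈ₗ L → v ≢ h
    v≢h v∈L = adj⇒≢ (proj₂ (adjacent v∈L)) ∘ sym
    finish : ∀ s {x y} (swept : Swept (fullBut s) L x y) →
             (∀ {c} → PegAtIf (evenLength L) c x y → PegAt c p h) →
             (∀ {v} → v ≢ p → v ≢ h → v ≢ x × v ≢ y × v ≢ s) → ClearedFromOneHole L h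
    finish s swept orient others = record
      { start = s ; result = result ; reach = reach ; cleared = cleared
      ; hole = proj₂ (orient pivots) ; pegs = pegs }
      where
      open Swept swept
      pegs : ∀ {v} → v ∉ₗ L → v ≢ h → lookup result v ≡ true
      pegs {v} v∉L v≢h with v ≟ p
      ... | yes refl = proj₁ (orient pivots)
      ... | no v≢p   = let (v≢x , v≢y , v≢s) = others v≢p v≢h in trans (framed v∉L v≢x v≢y) (fullBut-peg v≢s)
    by-parity : ∀ e → evenLength L ≡ e → ClearedFromOneHole L h
    by-parity true parity =
      finish h (sweep L L-unique (fullBut-peg p≢h , fullBut-hole h) (λ v∈L → fullBut-peg (v≢h v∈L) , adjacent v∈L))
        (λ {c} → subst (λ e → PegAtIf e c p h) parity)
        (λ v≢p v≢h → v≢p , v≢h , v≢h)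
    by-parity false parity =
      finish p (sweep L L-unique (fullBut-peg (p≢h ∘ sym) , fullBut-hole p)
                 (λ v∈L → fullBut-peg (v≢p v∈L) , proj₂ (adjacent v∈L) , proj₁ (adjacent v∈L)))
        (λ {c} → subst (λ e → PegAtIf e c h p) parity)
        (λ v≢p v≢h → v≢h , v≢p , v≢p)

  independent⇒noJump : ∀ {t} → Independent K t → NoJump K t
  independent⇒noJump t-indep _ (jump _ _ _ _ _ xy _ x∈t y∈t _) = independent-¬adj {G = K} t-indep x∈t y∈t xy

module Bipartition {N : ℕ} (K : Graph N) (side : Fin N → Bool)
                   (cross : ∀ {x y} → side x ≢ side y → adj K x y ≡ true) where

  open Solitaire K

  TwoOn : Bool → Set
  TwoOn b = ∃[ x ] ∃[ y ] x ≢ y × side x ≡ b × side y ≡ b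

  EdgeOn : Bool → Set
  EdgeOn b = ∃[ x ] ∃[ y ] side x ≡ b × side y ≡ b × adj K x y ≡ true

  ≢-not : ∀ {a c : Bool} → c ≡ not a → a ≢ c
  ≢-not c≡¬a a≡c = not-¬ (sym a≡c) c≡¬a

  peg≢hole : ∀ {t : Subset N} {x z} → x ∈ t → z ∉ t → x ≢ z
  peg≢hole x∈t z∉t refl = z∉t x∈t

  -- If x, y and z lie on one side, a vertex w of the other side gives the jump x y w or x w z.
  jump-available : (∀ b → ∃[ w ] side w ≡ b) → ∀ {t x y z} →
                   x ∈ t → y ∈ t → z ∉ t → adj K x y ≡ true → ∃[ d ] Jump K t d
  jump-available inhabited {t} {x} {y} {z} x∈t y∈t z∉t xy with side y Bool.≟ side z
  ... | no y≁z = _ , jump t x y z (peg≢hole x∈t z∉t) xy (cross y≁z) x∈t y∈t z∉t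
  ... | yes y∼z with side x Bool.≟ side y
  ...   | no x≁y  = _ , jump t y x z (peg≢hole y∈t z∉t) (adj-flip xy)
                          (cross (λ x∼z → x≁y (trans x∼z (sym y∼z)))) y∈t x∈t z∉t
  ...   | yes x∼y = via (inhabited (not (side x)))
    where
    via : ∃[ w ] side w ≡ not (side x) → ∃[ d ] Jump K t d
    via (w , w-opposite) with w ∈? t
    ... | no w∉t  = _ , jump t x y w (peg≢hole x∈t w∉t) xy (cross (≢-not w-opposite ∘ trans x∼y)) x∈t y∈t w∉t
    ... | yes w∈t = _ , jump t x w z (peg≢hole x∈t z∉t) (cross (≢-not w-opposite))
                          (cross (λ w∼z → ≢-not w-opposite (trans x∼y (trans y∼z (sym w∼z))))) x∈t w∈t z∉t

  terminal⇒independent : (∀ b → ∃[ w ] side w ≡ b) → ∀ {t} → Terminal K t → Independent K t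
  terminal⇒independent inhabited {t} (no-jump , _ , (h , h∉s , _) , s⇝t) x y x∈t y∈t with adj K x y in xy
  ... | false = refl
  ... | true  with hole-persists s⇝t (h , h∉s)
  ...   | z , z∉t = ⊥-elim (no-jump _ (proj₂ (jump-available inhabited x∈t y∈t z∉t xy)))

  module Reachability (b : Bool) (T : Subset N) (T-on-b : ∀ {v} → lookup T v ≡ true → side v ≡ b) where

    across : ∀ {x y} → side x ≡ b → side y ≡ not b → adj K x y ≡ true
    across x-on-b y-off-b = cross (λ x∼y → not-¬ (trans (sym x∼y) x-on-b) y-off-b)

    across′ : ∀ {x y} → side x ≡ b → side y ≡ not b → adj K y x ≡ true
    across′ x-on-b y-off-b = adj-flip (across x-on-b y-off-b)

    ≢-across : ∀ {x y} → side x ≡ b → side y ≡ not b → x ≢ y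
    ≢-across x-on-b y-off-b = adj⇒≢ (across x-on-b y-off-b)

    ≢-across′ : ∀ {x y} → side x ≡ not b → side y ≡ b → x ≢ y
    ≢-across′ x-off-b y-on-b = ≢-across y-on-b x-off-b ∘ sym

    ≢-by-T : ∀ {x y} → lookup T x ≡ true → lookup T y ≡ false → x ≢ y
    ≢-by-T Tx Ty refl with () ← trans (sym Tx) Ty

    T-off-b : ∀ {v} → side v ≡ not b → lookup T v ≡ false
    T-off-b {v} v-off-b with lookup T v in Tv
    ... | true  = ⊥-elim (not-¬ (T-on-b Tv) v-off-b)
    ... | false = refl

    on-b-or-off : ∀ v → side v ≡ b ⊎ side v ≡ not b
    on-b-or-off v with side v Bool.≟ b
    ... | yes v-on-b = inj₁ v-on-b
    ... | no  v≁b    = inj₂ (¬-not v≁b)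

    Opposite : Fin N → Fin N → Fin N → Set
    Opposite x y v = side v ≡ not b × v ≢ x × v ≢ y

    Surplus : Fin N → Set
    Surplus v = side v ≡ b × lookup T v ≡ false

    opposite? : ∀ x y → Decidable (Opposite x y)
    opposite? x y v = (side v Bool.≟ not b) ×-dec ¬? (v ≟ x) ×-dec ¬? (v ≟ y)

    surplus? : Decidable Surplus
    surplus? v = (side v Bool.≟ b) ×-dec (lookup T v Bool.≟ false)

    surplus-except? : ∀ u → Decidable (λ v → Surplus v × v ≢ u)
    surplus-except? u v = surplus? v ×-dec ¬? (v ≟ u)

    open module Opposites x y = Enumeration (opposite? x y) using ()
      renaming (enumerate to opposite; ∈-enumerate⁺ to ∈-opposite⁺; ∈-enumerate⁻ to ∈-opposite⁻;
                enumerate-unique to opposite-unique)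
    open Enumeration surplus? using ()
      renaming (enumerate to surplus; ∈-enumerate⁺ to ∈-surplus⁺; ∈-enumerate⁻ to ∈-surplus⁻;
                enumerate-unique to surplus-unique)
    open module SurplusExcept u = Enumeration (surplus-except? u) using ()
      renaming (enumerate to surplus-except; ∈-enumerate⁺ to ∈-surplus-except⁺;
                ∈-enumerate⁻ to ∈-surplus-except⁻; enumerate-unique to surplus-except-unique)

    ∉-opposite-on-b : ∀ {x y v} → side v ≡ b → v ∉ₗ opposite x y
    ∉-opposite-on-b v-on-b v∈ = not-¬ v-on-b (proj₁ (∈-opposite⁻ _ _ v∈))

    ¬surplus-in-T : ∀ {v} → lookup T v ≡ true → ¬ Surplus v
    ¬surplus-in-T Tv (_ , Tv≡false) = ≢-by-T Tv Tv≡false refl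

    ¬surplus-off-b : ∀ {v} → side v ≡ not b → ¬ Surplus v
    ¬surplus-off-b v-off-b (v-on-b , _) = not-¬ v-on-b v-off-b

    ∉-surplus : ∀ {v} → ¬ Surplus v → v ∉ₗ surplus
    ∉-surplus ¬surplus v∈ = ¬surplus (∈-surplus⁻ v∈)

    ∉-surplus-except : ∀ {u v} → ¬ Surplus v → v ∉ₗ surplus-except u
    ∉-surplus-except ¬surplus v∈ = ¬surplus (proj₁ (∈-surplus-except⁻ _ v∈))

    data Kind (v : Fin N) : Set where
      in-T  : lookup T v ≡ true → Kind v
      extra : Surplus v → Kind v
      off-b : side v ≡ not b → Kind v

    kind : ∀ v → Kind v
    kind v with lookup T v in Tv | on-b-or-off v
    ... | true  | _           = in-T Tv
    ... | false | inj₁ v-on-b = extra (v-on-b , Tv)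
    ... | false | inj₂ v-off  = off-b v-off

    -- Bounce the surplus away between q₂ and q₁; then bounce q₂ and the rest of side (not b) away between s and u:
    -- an even number of vertices, so the peg ends on s.
    reach-odd : ∀ {s u q₁ q₂} → lookup T s ≡ true → Surplus u → side q₁ ≡ not b → side q₂ ≡ not b → q₁ ≢ q₂ →
                evenLength (opposite q₁ q₂) ≡ false → ∃[ h ] fullBut h ⇝ T
    reach-odd {s} {u} {q₁} {q₂} Ts (u-on-b , Tu) q₁-off q₂-off q₁≢q₂ odd =
      C.start , subst (fullBut C.start ⇝_) (lookup-ext agrees) (⇝-trans C.reach W.reach)
      where
      s-on-b : side s ≡ b
      s-on-b = T-on-b Ts
      module C = ClearedFromOneHole (clear-from-one-hole surplus (q₁≢q₂ ∘ sym) surplus-unique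
                   (λ v∈ → across′ (proj₁ (∈-surplus⁻ v∈)) q₂-off , across′ (proj₁ (∈-surplus⁻ v∈)) q₁-off))
      L : List (Fin N)
      L = q₂ ∷ opposite q₁ q₂
      ∉L-on-b : ∀ {v} → side v ≡ b → v ∉ₗ L
      ∉L-on-b v-on-b (here refl) = not-¬ v-on-b q₂-off
      ∉L-on-b v-on-b (there v∈)  = ∉-opposite-on-b v-on-b v∈
      pegged : ∀ {v} → side v ≡ not b → v ≢ q₁ → lookup C.result v ≡ true
      pegged v-off v≢q₁ = C.pegs (∉-surplus (¬surplus-off-b v-off)) v≢q₁
      swept : Swept C.result L s u
      swept = sweep L ((All.tabulate λ v∈ → proj₂ (proj₂ (∈-opposite⁻ _ _ v∈)) ∘ sym) ∷ opposite-unique q₁ q₂)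
                (C.pegs (∉-surplus (¬surplus-in-T Ts)) (≢-across s-on-b q₁-off) , C.cleared (∈-surplus⁺ (u-on-b , Tu)))
                λ { (here refl) → pegged q₂-off (q₁≢q₂ ∘ sym) , across s-on-b q₂-off , across u-on-b q₂-off
                  ; (there v∈)  → let (v-off , v≢q₁ , _) = ∈-opposite⁻ _ _ v∈ in
                                  pegged v-off v≢q₁ , across s-on-b v-off , across u-on-b v-off }
      module W = Swept swept
      final : PegAt W.result s u
      final = subst (λ e → PegAtIf e W.result s u) (cong not odd) W.pivots
      agrees : ∀ v → lookup W.result v ≡ lookup T v
      agrees v with kind v
      ... | in-T Tv with v ≟ s
      ...   | yes refl = trans (proj₁ final) (sym Tv)
      ...   | no v≢s   = trans (W.framed (∉L-on-b (T-on-b Tv)) v≢s (≢-by-T Tv Tu))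
                           (trans (C.pegs (∉-surplus (¬surplus-in-T Tv)) (≢-across (T-on-b Tv) q₁-off)) (sym Tv))
      agrees v | extra (v-on-b , Tv) with v ≟ u
      ...   | yes refl = trans (proj₂ final) (sym Tv)
      ...   | no v≢u   = trans (W.framed (∉L-on-b v-on-b) (≢-by-T Ts Tv ∘ sym) v≢u)
                           (trans (C.cleared (∈-surplus⁺ (v-on-b , Tv))) (sym Tv))
      agrees v | off-b v-off with v ≟ q₂ | v ≟ q₁
      ... | yes refl | _        = trans (W.cleared (here refl)) (sym (T-off-b v-off))
      ... | no v≢q₂  | yes refl = trans (W.framed q₁∉L (≢-across′ v-off s-on-b) (≢-across′ v-off u-on-b))
                                    (trans C.hole (sym (T-off-b v-off)))
        where
        q₁∉L : q₁ ∉ₗ L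
        q₁∉L (here q₁≡q₂) = q₁≢q₂ q₁≡q₂
        q₁∉L (there q₁∈)  = proj₁ (proj₂ (∈-opposite⁻ _ _ q₁∈)) refl
      ... | no v≢q₂  | no v≢q₁  = trans (W.cleared (there (∈-opposite⁺ _ _ (v-off , v≢q₁ , v≢q₂))))
                                    (sym (T-off-b v-off))

    record OneAcross (c : Subset N) (s q : Fin N) : Set where
      field
        hole-s   : lookup c s ≡ false
        peg-q    : lookup c q ≡ true
        pegs-b   : ∀ {v} → side v ≡ b → v ≢ s → lookup c v ≡ true
        holes-¬b : ∀ {v} → side v ≡ not b → v ≢ q → lookup c v ≡ false

    -- Bounce the surplus except u away between q and q′, then jump u over whichever of q, q′ holds the peg into s.
    one-across⇝T : ∀ {c s u q q′} → OneAcross c s q → lookup T s ≡ true → Surplus u →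
                   side q ≡ not b → side q′ ≡ not b → q′ ≢ q → c ⇝ T
    one-across⇝T {c} {s} {u} {q} {q′} across-c Ts (u-on-b , Tu) q-off q′-off q′≢q =
      ⇝-trans W.reach (land (PegAtIf⇒PegAt _ W.pivots))
      where
      open OneAcross across-c
      s-on-b : side s ≡ b
      s-on-b = T-on-b Ts
      u≢s : u ≢ s
      u≢s = ≢-by-T Ts Tu ∘ sym
      swept : Swept c (surplus-except u) q q′
      swept = sweep (surplus-except u) (surplus-except-unique u) (peg-q , holes-¬b q′-off q′≢q)
                λ v∈ → let ((v-on-b , Tv) , _) = ∈-surplus-except⁻ u v∈ in
                       pegs-b v-on-b (≢-by-T Ts Tv ∘ sym) , across′ v-on-b q-off , across′ v-on-b q′-off
      module W = Swept swept
      framed-on-b : ∀ {v} → side v ≡ b → ¬ Surplus v → lookup W.result v ≡ lookup c v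
      framed-on-b v-on-b ¬surplus =
        W.framed (∉-surplus-except ¬surplus) (≢-across v-on-b q-off) (≢-across v-on-b q′-off)
      land-from : ∀ {p h} → side p ≡ not b → side h ≡ not b → PegAt W.result p h →
                  (∀ {v} → v ≢ p → v ≢ h → v ≢ q × v ≢ q′) → W.result ⇝ T
      land-from {p} {h} p-off h-off (peg-p , hole-h) others =
        subst (W.result ⇝_) (lookup-ext agrees)
          (jump-⇝ u≢s (across u-on-b p-off) (across′ s-on-b p-off)
            (trans (W.framed (λ u∈ → proj₂ (∈-surplus-except⁻ u u∈) refl) (≢-across u-on-b q-off) (≢-across u-on-b q′-off))
                   (pegs-b u-on-b u≢s))
            peg-p
            (trans (framed-on-b s-on-b (¬surplus-in-T Ts)) hole-s))
        where
        agrees : ∀ v → lookup (jumped W.result u p s) v ≡ lookup T v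
        agrees v with kind v
        ... | in-T Tv with v ≟ s
        ...   | yes refl = trans (jumped-target W.result u p s) (sym Tv)
        ...   | no v≢s   = trans (jumped-frame W.result (≢-by-T Tv Tu) (≢-across (T-on-b Tv) p-off) v≢s)
                             (trans (framed-on-b (T-on-b Tv) (¬surplus-in-T Tv)) (trans (pegs-b (T-on-b Tv) v≢s) (sym Tv)))
        agrees v | extra (v-on-b , Tv) with v ≟ u
        ...   | yes refl = trans (jumped-source W.result p u≢s) (sym Tv)
        ...   | no v≢u   = trans (jumped-frame W.result v≢u (≢-across v-on-b p-off) (≢-by-T Ts Tv ∘ sym))
                             (trans (W.cleared (∈-surplus-except⁺ u ((v-on-b , Tv) , v≢u))) (sym Tv))
        agrees v | off-b v-off with v ≟ p | v ≟ h
        ... | yes refl | _        = trans (jumped-middle W.result u (≢-across′ p-off s-on-b)) (sym (T-off-b p-off))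
        ... | no v≢p   | yes refl = trans (jumped-frame W.result (≢-across′ v-off u-on-b) v≢p (≢-across′ v-off s-on-b))
                                      (trans hole-h (sym (T-off-b v-off)))
        ... | no v≢p   | no v≢h   =
          let (v≢q , v≢q′) = others v≢p v≢h in
          trans (jumped-frame W.result (≢-across′ v-off u-on-b) v≢p (≢-across′ v-off s-on-b))
            (trans (W.framed (∉-surplus-except (¬surplus-off-b v-off)) v≢q v≢q′)
              (trans (holes-¬b v-off v≢q) (sym (T-off-b v-off))))
      land : PegAt W.result q q′ ⊎ PegAt W.result q′ q → W.result ⇝ T
      land (inj₁ peg) = land-from q-off q′-off peg (λ v≢q v≢q′ → v≢q , v≢q′)
      land (inj₂ peg) = land-from q′-off q-off peg (λ v≢q′ v≢q → v≢q , v≢q′)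

    -- With an even number of vertices bounced away the peg returns to s, so the jump s q₁ u is then available.
    even-setup : ∀ {s u q₁ q₂} → lookup T s ≡ true → Surplus u → side q₁ ≡ not b → side q₂ ≡ not b → q₁ ≢ q₂ →
                 evenLength (opposite q₁ q₂) ≡ true → ∃[ c ] fullBut u ⇝ c × OneAcross c s q₂
    even-setup {s} {u} {q₁} {q₂} Ts (u-on-b , Tu) q₁-off q₂-off q₁≢q₂ even =
      jumped W.result s q₁ u ,
      ⇝-trans W.reach (jump-⇝ s≢u (across s-on-b q₁-off) (across′ u-on-b q₁-off) (proj₁ peg) peg-q₁ (proj₂ peg)) ,
      record { hole-s = jumped-source W.result q₁ s≢u ; peg-q = peg-q₂ ; pegs-b = pegs-b ; holes-¬b = holes-¬b }
      where
      s-on-b : side s ≡ b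
      s-on-b = T-on-b Ts
      s≢u : s ≢ u
      s≢u = ≢-by-T Ts Tu
      swept : Swept (fullBut u) (opposite q₁ q₂) s u
      swept = sweep (opposite q₁ q₂) (opposite-unique q₁ q₂) (fullBut-peg s≢u , fullBut-hole u)
                λ v∈ → let (v-off , _) = ∈-opposite⁻ _ _ v∈ in
                       fullBut-peg (≢-across′ v-off u-on-b) , across s-on-b v-off , across u-on-b v-off
      module W = Swept swept
      peg : PegAt W.result s u
      peg = subst (λ e → PegAtIf e W.result s u) even W.pivots
      untouched-off-b : ∀ {v} → side v ≡ not b → v ∉ₗ opposite q₁ q₂ → lookup W.result v ≡ true
      untouched-off-b v-off v∉ =
        trans (W.framed v∉ (≢-across′ v-off s-on-b) (≢-across′ v-off u-on-b)) (fullBut-peg (≢-across′ v-off u-on-b))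
      peg-q₁ : lookup W.result q₁ ≡ true
      peg-q₁ = untouched-off-b q₁-off (λ q₁∈ → proj₁ (proj₂ (∈-opposite⁻ _ _ q₁∈)) refl)
      peg-q₂ : lookup (jumped W.result s q₁ u) q₂ ≡ true
      peg-q₂ = trans (jumped-frame W.result (≢-across′ q₂-off s-on-b) (q₁≢q₂ ∘ sym) (≢-across′ q₂-off u-on-b))
                 (untouched-off-b q₂-off (λ q₂∈ → proj₂ (proj₂ (∈-opposite⁻ _ _ q₂∈)) refl))
      pegs-b : ∀ {v} → side v ≡ b → v ≢ s → lookup (jumped W.result s q₁ u) v ≡ true
      pegs-b {v} v-on-b v≢s with v ≟ u
      ... | yes refl = jumped-target W.result s q₁ u
      ... | no v≢u   = trans (jumped-frame W.result v≢s (≢-across v-on-b q₁-off) v≢u)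
                         (trans (W.framed (∉-opposite-on-b v-on-b) v≢s v≢u) (fullBut-peg v≢u))
      holes-¬b : ∀ {v} → side v ≡ not b → v ≢ q₂ → lookup (jumped W.result s q₁ u) v ≡ false
      holes-¬b {v} v-off v≢q₂ with v ≟ q₁
      ... | yes refl = jumped-middle W.result s (≢-across′ q₁-off u-on-b)
      ... | no v≢q₁  = trans (jumped-frame W.result (≢-across′ v-off s-on-b) v≢q₁ (≢-across′ v-off u-on-b))
                         (W.cleared (∈-opposite⁺ _ _ (v-off , v≢q₁ , v≢q₂)))

    -- Side b is all of T: bounce side (not b) except the edge cd away between a₂ and a₁, then jump c d a₁.
    reach-full : ∀ {a₁ a₂ c d} → (∀ {v} → side v ≡ b → lookup T v ≡ true) → side a₁ ≡ b → side a₂ ≡ b → a₁ ≢ a₂ →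
                 side c ≡ not b → side d ≡ not b → adj K c d ≡ true → ∃[ h ] fullBut h ⇝ T
    reach-full {a₁} {a₂} {c} {d} full a₁-on-b a₂-on-b a₁≢a₂ c-off d-off cd =
      C.start ,
      subst (fullBut C.start ⇝_) (lookup-ext agrees)
        (⇝-trans C.reach (jump-⇝ (≢-across′ c-off a₁-on-b) cd (across′ a₁-on-b d-off)
                            (pegged-off-b c-off (λ c∈ → proj₁ (proj₂ (∈-opposite⁻ _ _ c∈)) refl))
                            (pegged-off-b d-off (λ d∈ → proj₂ (proj₂ (∈-opposite⁻ _ _ d∈)) refl))
                            C.hole))
      where
      module C = ClearedFromOneHole (clear-from-one-hole (opposite c d) (a₁≢a₂ ∘ sym) (opposite-unique c d)
                   (λ v∈ → across a₂-on-b (proj₁ (∈-opposite⁻ _ _ v∈)) , across a₁-on-b (proj₁ (∈-opposite⁻ _ _ v∈))))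
      pegged-off-b : ∀ {v} → side v ≡ not b → v ∉ₗ opposite c d → lookup C.result v ≡ true
      pegged-off-b v-off v∉ = C.pegs v∉ (≢-across′ v-off a₁-on-b)
      agrees : ∀ v → lookup (jumped C.result c d a₁) v ≡ lookup T v
      agrees v with on-b-or-off v
      ... | inj₁ v-on-b with v ≟ a₁
      ...   | yes refl = trans (jumped-target C.result c d a₁) (sym (full v-on-b))
      ...   | no v≢a₁  = trans (jumped-frame C.result (≢-across v-on-b c-off) (≢-across v-on-b d-off) v≢a₁)
                           (trans (C.pegs (∉-opposite-on-b v-on-b) v≢a₁) (sym (full v-on-b)))
      agrees v | inj₂ v-off with v ≟ c | v ≟ d
      ...   | yes refl | _        = trans (jumped-source C.result d (≢-across′ c-off a₁-on-b)) (sym (T-off-b v-off))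
      ...   | no v≢c   | yes refl = trans (jumped-middle C.result c (≢-across′ d-off a₁-on-b)) (sym (T-off-b v-off))
      ...   | no v≢c   | no v≢d   = trans (jumped-frame C.result v≢c v≢d (≢-across′ v-off a₁-on-b))
                                      (trans (C.cleared (∈-opposite⁺ _ _ (v-off , v≢c , v≢d))) (sym (T-off-b v-off)))

    reachable : ∀ {s} → lookup T s ≡ true → TwoOn b → TwoOn (not b) →
                ((∀ {v} → side v ≡ b → lookup T v ≡ true) → EdgeOn (not b)) → ∃[ h ] fullBut h ⇝ T
    reachable Ts (a₁ , a₂ , a₁≢a₂ , a₁-on-b , a₂-on-b) (q₁ , q₂ , q₁≢q₂ , q₁-off , q₂-off) opposite-edge
      with any? surplus?
    ... | yes (u , u-surplus) with evenLength (opposite q₁ q₂) in parity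
    ...   | true  = let (c , u⇝c , one-across) = even-setup Ts u-surplus q₁-off q₂-off q₁≢q₂ parity in
                    _ , ⇝-trans u⇝c (one-across⇝T one-across Ts u-surplus q₂-off q₁-off q₁≢q₂)
    ...   | false = reach-odd Ts u-surplus q₁-off q₂-off q₁≢q₂ parity
    reachable Ts (a₁ , a₂ , a₁≢a₂ , a₁-on-b , a₂-on-b) _ opposite-edge | no no-surplus =
      let (c , d , c-off , d-off , cd) = opposite-edge full in reach-full full a₁-on-b a₂-on-b a₁≢a₂ c-off d-off cd
      where
      full : ∀ {v} → side v ≡ b → lookup T v ≡ true
      full {v} v-on-b with lookup T v in Tv
      ... | true  = refl
      ... | false = ⊥-elim (no-surplus (v , v-on-b , Tv))

  independent⇒terminal : (∀ b → TwoOn b) → ∃[ b ] EdgeOn b → ∀ {S s} → Independent K S → s ∈ S → Terminal K S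
  independent⇒terminal two-on (b , x , y , x-on-b , y-on-b , xy) {S} {s} S-indep s∈S =
    let (h , h⇝S) = reachable ([]=⇒lookup s∈S) (two-on (side s)) (two-on (not (side s))) opposite-edge
    in independent⇒noJump S-indep , fullBut h , fullBut-oneHole h , h⇝S
    where
    on-side-of-s : ∀ {v} → lookup S v ≡ true → side v ≡ side s
    on-side-of-s {v} Sv with side v Bool.≟ side s
    ... | yes v∼s = v∼s
    ... | no  v≁s = ⊥-elim (independent-¬adj {G = K} S-indep (lookup⇒[]= v S Sv) s∈S (cross v≁s))
    open Reachability (side s) S on-side-of-s
    opposite-edge : (∀ {v} → side v ≡ side s → lookup S v ≡ true) → EdgeOn (not (side s))
    opposite-edge full with b Bool.≟ side s
    ... | yes b≡s = ⊥-elim (independent-¬adj {G = K} S-indep (lookup⇒[]= x S (full (trans x-on-b b≡s)))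
                                                   (lookup⇒[]= y S (full (trans y-on-b b≡s))) xy)
    ... | no  b≢s = x , y , trans x-on-b (¬-not b≢s) , trans y-on-b (¬-not b≢s) , xy

isInj₁ : ∀ {A B : Set} → A ⊎ B → Bool
isInj₁ (inj₁ _) = true
isInj₁ (inj₂ _) = false

module Join {m n : ℕ} (G : Graph m) (H : Graph n) where

  inG : Fin (m + n) → Bool
  inG v = isInj₁ (splitAt m v)

  inG-↑ˡ : ∀ i → inG (i ↑ˡ n) ≡ true
  inG-↑ˡ i rewrite splitAt-↑ˡ m i n = refl

  inG-↑ʳ : ∀ j → inG (m ↑ʳ j) ≡ false
  inG-↑ʳ j rewrite splitAt-↑ʳ m n j = refl

  adj-↑ˡ : ∀ i j → adj (G ∨ᴳ H) (i ↑ˡ n) (j ↑ˡ n) ≡ adj G i j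
  adj-↑ˡ i j rewrite splitAt-↑ˡ m i n | splitAt-↑ˡ m j n = refl

  adj-↑ʳ : ∀ i j → adj (G ∨ᴳ H) (m ↑ʳ i) (m ↑ʳ j) ≡ adj H i j
  adj-↑ʳ i j rewrite splitAt-↑ʳ m n i | splitAt-↑ʳ m n j = refl

  join-cross : ∀ {x y} → inG x ≢ inG y → adj (G ∨ᴳ H) x y ≡ true
  join-cross {x} {y} x≁y with splitAt m x | splitAt m y
  ... | inj₁ _ | inj₁ _ = ⊥-elim (x≁y refl)
  ... | inj₁ _ | inj₂ _ = refl
  ... | inj₂ _ | inj₁ _ = refl
  ... | inj₂ _ | inj₂ _ = ⊥-elim (x≁y refl)

  open Bipartition (G ∨ᴳ H) inG join-cross public

  two-on-each-side : 2 ≤ m → 2 ≤ n → ∀ b → TwoOn b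
  two-on-each-side (s≤s (s≤s _)) _ true  = zero , suc zero , 0≢1+n , refl , refl
  two-on-each-side _ (s≤s (s≤s _)) false =
    m ↑ʳ zero , m ↑ʳ suc zero , 0≢1+n ∘ ↑ʳ-injective m zero (suc zero) , inG-↑ʳ zero , inG-↑ʳ (suc zero)

  edge-somewhere : 1 ≤ numEdges G + numEdges H → ∃[ b ] EdgeOn b
  edge-somewhere edges with has-edge? G | has-edge? H
  ... | yes (i , j , ij) | _ = true , i ↑ˡ n , j ↑ˡ n , inG-↑ˡ i , inG-↑ˡ j , trans (adj-↑ˡ i j) ij
  ... | no _ | yes (i , j , ij) = false , m ↑ʳ i , m ↑ʳ j , inG-↑ʳ i , inG-↑ʳ j , trans (adj-↑ʳ i j) ij
  ... | no G-edgeless | no H-edgeless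
    with () ← subst (1 ≤_) (cong₂ _+_ (edgeless⇒numEdges≡0 G G-edgeless) (edgeless⇒numEdges≡0 H H-edgeless)) edges

theorem2p2 : ∀ {m n} (G : Graph m) (H : Graph n) →
    2 ≤ m → 2 ≤ n → 1 ≤ numEdges G + numEdges H →
    ∀ (a : ℕ) → IsIndependenceNumber (G ∨ᴳ H) a → IsFoolsSolitaireNumber (G ∨ᴳ H) a
theorem2p2 G H 2≤m@(s≤s _) 2≤n edges a ((S , S-indep , ∣S∣≡a) , S-max) =
  (S , S-terminal , ∣S∣≡a) , λ t t-terminal → S-max t (terminal⇒independent inhabited t-terminal)
  where
  open Join G H
  two-on : ∀ b → TwoOn b
  two-on = two-on-each-side 2≤m 2≤n
  inhabited : ∀ b → ∃[ w ] inG w ≡ b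
  inhabited b = let (w , _ , _ , w-on-b , _) = two-on b in w , w-on-b
  S-terminal : Terminal (G ∨ᴳ H) S
  S-terminal = let (s , s∈S) = maximum-independent-nonempty (G ∨ᴳ H) zero ∣S∣≡a S-max in
               independent⇒terminal two-on (edge-somewhere edges) S-indep s∈S
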